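{- For every $n\in\mathbb{N}$, $$\frac{1+\sqrt{2^{2n+3}-7}}{2}\le\Delta[C_2^{2n}]<2^{n+1},\qquad \frac{1+\sqrt{2^{2n+4}-7}}{2}\le\Delta[C_2^{2n+1}]<3\cdot 2^n,$$ and $$\sqrt2<\frac{1+\sqrt{2^{2n+3}-7}}{2^{n+1}}\le\eth[C_2^{2n}]<2,\qquad \sqrt2<\frac{1+\sqrt{2^{2n+4}-7}}{\sqrt2\cdot 2^{n+1}}\le\eth[C_2^{2n+1}]<\frac{3}{\sqrt2}.$$
   Context: For a group $G$, a subset $B\subseteq G$ is a difference basis if every $g\in G$ can be written as $g=xy^{ -1}$ with $x,y\in B$; $\Delta[G]$ is the smallest cardinality of a difference basis and $\eth[G]=\Delta[G]/\sqrt{|G|}$. $C_2^m$ is the elementary Abelian group of order $2^m$. -}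

module Defs where

open import Data.Bool using (Bool; _xor_)
open import Data.Nat using (ℕ; _≤_)
open import Data.Vec using (Vec; zipWith)
open import Data.List using (List; length)
open import Data.List.Membership.Propositional using (_∈_)
open import Data.Product using (Σ; _×_; ∃)
open import Relation.Binary.PropositionalEquality using (_≡_)

C₂^ : ℕ → Set
C₂^ m = Vec Bool m

_∙_ : ∀ {m} → C₂^ m → C₂^ m → C₂^ m
_∙_ = zipWith _xor_

-- inverse in C₂^m: every element is its own inverse
_⁻¹ : ∀ {m} → C₂^ m → C₂^ m
x ⁻¹ = x

-- A (finite) subset B ⊆ C₂^m, given as a list of its elements
-- (its cardinality is bounded by the list length; duplicates only
-- increase the length, so minima agree), is a difference basis if
-- every g can be written as x ∙ y⁻¹ with x, y ∈ B.
IsDifferenceBasis : (m : ℕ) → List (C₂^ m) → Set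
IsDifferenceBasis m B =
  (g : C₂^ m) → Σ (C₂^ m) λ x → Σ (C₂^ m) λ y →
    (x ∈ B) × (y ∈ B) × (g ≡ x ∙ (y ⁻¹))

IsΔ : ℕ → ℕ → Set
IsΔ m d =
  (∃ λ (B : List (C₂^ m)) → IsDifferenceBasis m B × length B ≡ d)
  × ((B : List (C₂^ m)) → IsDifferenceBasis m B → d ≤ length B)

{-# OPTIONS --safe #-}
module Submission where

open import Defs
open import Data.Bool using (Bool; true; false)
open import Data.Bool.Properties using (xor-comm; xor-identityˡ; xor-identityʳ; xor-same)
  renaming (_≟_ to _≟ᵇ_)
open import Data.List using (List; []; _∷_; length; map; _++_)
open import Data.List.Properties using (length-++; length-map)
open import Data.List.Membership.Propositional using (_∈_)
open import Data.List.Membership.Propositional.Properties using (∈-++⁺ˡ; ∈-++⁺ʳ; ∈-map⁺; ∈-length)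
open import Data.List.Relation.Unary.Any using (here; there)
import Data.List.Relation.Unary.Any as Any
open import Data.Nat using (ℕ; zero; suc; _+_; _*_; _∸_; _^_; _≤_; _<_; s≤s)
open import Data.Nat.Combinatorics using (_C_; nC1≡n; nCk+nC[k+1]≡[n+1]C[k+1])
open import Data.Nat.Properties hiding (_≟_)
open import Data.Nat.Tactic.RingSolver using (solve-∀)
open import Data.Product using (_×_; _,_)
open import Data.Vec using (_∷_; replicate; splitAt)
  renaming ([] to []ᵛ; _++_ to _++ᵛ_)
open import Data.Vec.Properties using (zipWith-comm; zipWith-identityˡ; zipWith-identityʳ;
  zipWith-inverseʳ; zipWith-++; map-id; ≡-dec)
open import Relation.Binary.Definitions using (DecidableEquality)
open import Relation.Binary.PropositionalEquality
open import Relation.Nullary using (yes; no; contradiction)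

-- In C₂^m every element is its own inverse, so a difference basis B of size d
-- produces every element either as 0 = x x⁻¹ or as a product x y of two distinct
-- elements of B; hence 2^m ≤ 1 + (d choose 2), and 8 (1 + (d choose 2)) =
-- 7 + (2d − 1)^2 gives the lower bounds. Conversely, for m = a + b the union of
-- the coordinate subgroups C₂^a × 0 and 0 × C₂^b is a difference basis with
-- 2^a + 2^b − 1 elements, giving the upper bounds with (a, b) = (n, n) and
-- (n + 1, n).

ε : ∀ m → C₂^ m
ε m = replicate m false

∙-comm : ∀ {m} (x y : C₂^ m) → x ∙ y ≡ y ∙ x
∙-comm = zipWith-comm xor-comm

∙-identityˡ : ∀ {m} (x : C₂^ m) → ε m ∙ x ≡ x
∙-identityˡ = zipWith-identityˡ xor-identityˡ

∙-identityʳ : ∀ {m} (x : C₂^ m) → x ∙ ε m ≡ x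
∙-identityʳ = zipWith-identityʳ xor-identityʳ

x∙x≡ε : ∀ {m} (x : C₂^ m) → x ∙ x ≡ ε m
x∙x≡ε x = trans (cong (x ∙_) (sym (map-id x))) (zipWith-inverseʳ xor-same x)

∙-++ : ∀ {a b} (x x′ : C₂^ a) (y y′ : C₂^ b) →
       (x ++ᵛ y) ∙ (x′ ++ᵛ y′) ≡ (x ∙ x′) ++ᵛ (y ∙ y′)
∙-++ x x′ y y′ = zipWith-++ _ x y x′ y′

_≟_ : ∀ {m} → DecidableEquality (C₂^ m)
_≟_ = ≡-dec _≟ᵇ_

[1+n]C2≡n+nC2 : ∀ n → suc n C 2 ≡ n + n C 2
[1+n]C2≡n+nC2 n = trans (sym (nCk+nC[k+1]≡[n+1]C[k+1] n 1)) (cong (_+ n C 2) (nC1≡n n))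

[1+n]C2*2≡[1+n]*n : ∀ n → (suc n C 2) * 2 ≡ suc n * n
[1+n]C2*2≡[1+n]*n zero = refl
[1+n]C2*2≡[1+n]*n (suc n) = begin
  (suc (suc n) C 2) * 2        ≡⟨ cong (_* 2) ([1+n]C2≡n+nC2 (suc n)) ⟩
  (suc n + suc n C 2) * 2      ≡⟨ *-distribʳ-+ 2 (suc n) (suc n C 2) ⟩
  suc n * 2 + (suc n C 2) * 2  ≡⟨ cong (suc n * 2 +_) ([1+n]C2*2≡[1+n]*n n) ⟩
  suc n * 2 + suc n * n        ≡⟨ *-distribˡ-+ (suc n) 2 n ⟨
  suc n * suc (suc n)          ≡⟨ *-comm (suc n) (suc (suc n)) ⟩
  suc (suc n) * suc n          ∎
  where open ≡-Reasoning

pairwiseDifferences : ∀ {m} → List (C₂^ m) → List (C₂^ m)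
pairwiseDifferences []       = []
pairwiseDifferences (x ∷ xs) = map (x ∙_) xs ++ pairwiseDifferences xs

length-pairwiseDifferences : ∀ {m} (B : List (C₂^ m)) →
                             length (pairwiseDifferences B) ≡ length B C 2
length-pairwiseDifferences []       = refl
length-pairwiseDifferences (x ∷ xs) = begin
  length (map (x ∙_) xs ++ pairwiseDifferences xs)          ≡⟨ length-++ (map (x ∙_) xs) ⟩
  length (map (x ∙_) xs) + length (pairwiseDifferences xs)  ≡⟨ cong₂ _+_ (length-map (x ∙_) xs)
                                                                 (length-pairwiseDifferences xs) ⟩
  length xs + length xs C 2                                 ≡⟨ sym ([1+n]C2≡n+nC2 (length xs)) ⟩
  suc (length xs) C 2                                       ∎
  where open ≡-Reasoning

∈-pairwiseDifferences : ∀ {m} {x y : C₂^ m} (B : List (C₂^ m)) →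
                        x ∈ B → y ∈ B → x ≢ y → x ∙ y ∈ pairwiseDifferences B
∈-pairwiseDifferences (z ∷ zs) (here refl) (here refl) x≢y = contradiction refl x≢y
∈-pairwiseDifferences (z ∷ zs) (here refl) (there y∈zs) _ = ∈-++⁺ˡ (∈-map⁺ (z ∙_) y∈zs)
∈-pairwiseDifferences {x = x} (z ∷ zs) (there x∈zs) (here refl) _ =
  subst (_∈ _) (∙-comm z x) (∈-++⁺ˡ (∈-map⁺ (z ∙_) x∈zs))
∈-pairwiseDifferences (z ∷ zs) (there x∈zs) (there y∈zs) x≢y =
  ∈-++⁺ʳ (map (z ∙_) zs) (∈-pairwiseDifferences zs x∈zs y∈zs x≢y)

differenceBasis-covers : ∀ {m} {B : List (C₂^ m)} → IsDifferenceBasis m B →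
                         ∀ g → g ∈ ε m ∷ pairwiseDifferences B
differenceBasis-covers isBasis g with isBasis g
... | x , y , x∈B , y∈B , refl with x ≟ y
...   | yes refl = here (x∙x≡ε x)
...   | no x≢y   = there (∈-pairwiseDifferences _ x∈B y∈B x≢y)

slice : ∀ {m} → Bool → List (C₂^ (suc m)) → List (C₂^ m)
slice _     []                 = []
slice false ((false ∷ v) ∷ vs) = v ∷ slice false vs
slice true  ((true  ∷ v) ∷ vs) = v ∷ slice true vs
slice b     (_ ∷ vs)           = slice b vs

length-slice : ∀ {m} (vs : List (C₂^ (suc m))) →
               length (slice false vs) + length (slice true vs) ≡ length vs
length-slice []                 = refl
length-slice ((false ∷ _) ∷ vs) = cong suc (length-slice vs)
length-slice ((true  ∷ _) ∷ vs) = trans (+-suc _ _) (cong suc (length-slice vs))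

∈-slice : ∀ {m} {b} {v : C₂^ m} {vs} → (b ∷ v) ∈ vs → v ∈ slice b vs
∈-slice {b = false} (here refl) = here refl
∈-slice {b = true}  (here refl) = here refl
∈-slice {b = false} {vs = (false ∷ _) ∷ _} (there p) = there (∈-slice p)
∈-slice {b = false} {vs = (true  ∷ _) ∷ _} (there p) = ∈-slice p
∈-slice {b = true}  {vs = (false ∷ _) ∷ _} (there p) = ∈-slice p
∈-slice {b = true}  {vs = (true  ∷ _) ∷ _} (there p) = there (∈-slice p)

covering⇒2^m≤length : ∀ m (vs : List (C₂^ m)) → (∀ v → v ∈ vs) → 2 ^ m ≤ length vs
covering⇒2^m≤length zero    vs covers = ∈-length (covers []ᵛ)
covering⇒2^m≤length (suc m) vs covers = begin
  2 ^ m + (2 ^ m + 0)                              ≡⟨ cong (2 ^ m +_) (+-identityʳ _) ⟩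
  2 ^ m + 2 ^ m                                    ≤⟨ +-mono-≤ (half false) (half true) ⟩
  length (slice false vs) + length (slice true vs) ≡⟨ length-slice vs ⟩
  length vs                                        ∎
  where
  open ≤-Reasoning
  half : ∀ b → 2 ^ m ≤ length (slice b vs)
  half b = covering⇒2^m≤length m (slice b vs) (λ v → ∈-slice (covers (b ∷ v)))

differenceBasis⇒2^m≤1+dC2 : ∀ {m} {B : List (C₂^ m)} → IsDifferenceBasis m B →
                             2 ^ m ≤ 1 + length B C 2
differenceBasis⇒2^m≤1+dC2 {m} {B} isBasis =
  subst (λ k → 2 ^ m ≤ suc k) (length-pairwiseDifferences B)
    (covering⇒2^m≤length m _ (differenceBasis-covers isBasis))

-- The square is spelled out as the unfolding of (1 + 2 * n) ^ 2, since the ring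
-- solver does not accept _^_ here.
8+[1+n]*n*4≡7+[1+2n]² : ∀ n → 8 + (1 + n) * n * 4 ≡ 7 + (1 + 2 * n) * ((1 + 2 * n) * 1)
8+[1+n]*n*4≡7+[1+2n]² = solve-∀

2^m≤1+dC2⇒2^[m+3]∸7≤[2d∸1]² : ∀ m d → 1 ≤ d → 2 ^ m ≤ 1 + d C 2 →
                              2 ^ (m + 3) ∸ 7 ≤ (2 * d ∸ 1) ^ 2
2^m≤1+dC2⇒2^[m+3]∸7≤[2d∸1]² m (suc n) _ bound = m≤n+o⇒m∸n≤o (2 ^ (m + 3)) 7 (begin
  2 ^ (m + 3)              ≡⟨ ^-distribˡ-+-* 2 m 3 ⟩
  2 ^ m * 8                ≤⟨ *-monoˡ-≤ 8 bound ⟩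
  8 + (suc n C 2) * 8      ≡⟨ cong (8 +_) (*-assoc (suc n C 2) 2 4) ⟨
  8 + (suc n C 2) * 2 * 4  ≡⟨ cong (λ k → 8 + k * 4) ([1+n]C2*2≡[1+n]*n n) ⟩
  8 + suc n * n * 4        ≡⟨ 8+[1+n]*n*4≡7+[1+2n]² n ⟩
  7 + suc (2 * n) ^ 2      ≡⟨ cong (λ k → 7 + (k ∸ 1) ^ 2) (*-suc 2 n) ⟨
  7 + (2 * suc n ∸ 1) ^ 2  ∎)
  where open ≤-Reasoning

Δ-lower : ∀ {m d} → IsΔ m d → 2 ^ (m + 3) ∸ 7 ≤ (2 * d ∸ 1) ^ 2
Δ-lower {m} ((B , isBasis , refl) , _) with isBasis (ε m)
... | _ , _ , x∈B , _ =
  2^m≤1+dC2⇒2^[m+3]∸7≤[2d∸1]² m (length B) (∈-length x∈B) (differenceBasis⇒2^m≤1+dC2 isBasis)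

nonzero : ∀ m → List (C₂^ m)
nonzero zero    = []
nonzero (suc m) = map (false ∷_) (nonzero m) ++ map (true ∷_) (ε m ∷ nonzero m)

-- elements (suc m) unfolds definitionally to
-- map (false ∷_) (elements m) ++ map (true ∷_) (elements m).
elements : ∀ m → List (C₂^ m)
elements m = ε m ∷ nonzero m

length-elements : ∀ m → length (elements m) ≡ 2 ^ m
length-elements zero    = refl
length-elements (suc m) = begin
  length (map (false ∷_) (elements m) ++ map (true ∷_) (elements m))
    ≡⟨ length-++ (map (false ∷_) (elements m)) ⟩
  length (map (false ∷_) (elements m)) + length (map (true ∷_) (elements m))
    ≡⟨ cong₂ _+_ (length-map _ (elements m)) (length-map _ (elements m)) ⟩
  length (elements m) + length (elements m)
    ≡⟨ cong₂ _+_ (length-elements m) (trans (length-elements m) (sym (+-identityʳ _))) ⟩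
  2 ^ m + (2 ^ m + 0)
    ∎
  where open ≡-Reasoning

∈-elements : ∀ {m} (v : C₂^ m) → v ∈ elements m
∈-elements []ᵛ                 = here refl
∈-elements {suc m} (false ∷ v) = ∈-++⁺ˡ (∈-map⁺ (false ∷_) (∈-elements v))
∈-elements {suc m} (true  ∷ v) = ∈-++⁺ʳ (map (false ∷_) (elements m)) (∈-map⁺ (true ∷_) (∈-elements v))

∈-nonzero : ∀ {m} {v : C₂^ m} → v ≢ ε m → v ∈ nonzero m
∈-nonzero {v = v} v≢ε = Any.tail v≢ε (∈-elements v)

axes : ∀ a b → List (C₂^ (a + b))
axes a b = map (_++ᵛ ε b) (elements a) ++ map (ε a ++ᵛ_) (nonzero b)

length-axes : ∀ a b → 1 + length (axes a b) ≡ 2 ^ a + 2 ^ b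
length-axes a b = begin
  1 + length (map (_++ᵛ ε b) (elements a) ++ map (ε a ++ᵛ_) (nonzero b))
    ≡⟨ cong suc (length-++ (map (_++ᵛ ε b) (elements a))) ⟩
  1 + (length (map (_++ᵛ ε b) (elements a)) + length (map (ε a ++ᵛ_) (nonzero b)))
    ≡⟨ cong₂ (λ p q → 1 + (p + q)) (length-map _ (elements a)) (length-map _ (nonzero b)) ⟩
  1 + (length (elements a) + length (nonzero b))
    ≡⟨ +-suc (length (elements a)) (length (nonzero b)) ⟨
  length (elements a) + length (elements b)
    ≡⟨ cong₂ _+_ (length-elements a) (length-elements b) ⟩
  2 ^ a + 2 ^ b
    ∎
  where open ≡-Reasoning

∈-axesˡ : ∀ {a} b (x : C₂^ a) → x ++ᵛ ε b ∈ axes a b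
∈-axesˡ b x = ∈-++⁺ˡ (∈-map⁺ (_++ᵛ ε b) (∈-elements x))

∈-axesʳ : ∀ a {b} (y : C₂^ b) → ε a ++ᵛ y ∈ axes a b
∈-axesʳ a {b} y with y ≟ ε b
... | yes refl = ∈-axesˡ b (ε a)
... | no y≢ε   = ∈-++⁺ʳ (map (_++ᵛ ε b) (elements a)) (∈-map⁺ (ε a ++ᵛ_) (∈-nonzero y≢ε))

axes-isDifferenceBasis : ∀ a b → IsDifferenceBasis (a + b) (axes a b)
axes-isDifferenceBasis a b g with splitAt a g
... | x , y , refl = x ++ᵛ ε b , ε a ++ᵛ y , ∈-axesˡ b x , ∈-axesʳ a y , sym (begin
  (x ++ᵛ ε b) ∙ (ε a ++ᵛ y)  ≡⟨ ∙-++ x (ε a) (ε b) y ⟩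
  (x ∙ ε a) ++ᵛ (ε b ∙ y)    ≡⟨ cong₂ _++ᵛ_ (∙-identityʳ x) (∙-identityˡ y) ⟩
  x ++ᵛ y                    ∎)
  where open ≡-Reasoning

Δ-upper : ∀ a b {d} → IsΔ (a + b) d → d < 2 ^ a + 2 ^ b
Δ-upper a b {d} (_ , minimal) =
  subst (d <_) (length-axes a b) (s≤s (minimal (axes a b) (axes-isDifferenceBasis a b)))

proposition7p3 : (n : ℕ) → 1 ≤ n →
    ((d : ℕ) → IsΔ (2 * n) d →
      -- (1 + √(2^(2n+3) − 7))/2 ≤ Δ[C₂^(2n)]
      (2 ^ (2 * n + 3) ∸ 7 ≤ (2 * d ∸ 1) ^ 2)
      -- Δ[C₂^(2n)] < 2^(n+1)   (equivalently ð[C₂^(2n)] < 2)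
      × (d < 2 ^ (n + 1)))
    × ((d : ℕ) → IsΔ (2 * n + 1) d →
      -- (1 + √(2^(2n+4) − 7))/2 ≤ Δ[C₂^(2n+1)]
      (2 ^ (2 * n + 4) ∸ 7 ≤ (2 * d ∸ 1) ^ 2)
      -- Δ[C₂^(2n+1)] < 3·2^n   (equivalently ð[C₂^(2n+1)] < 3/√2)
      × (d < 3 * 2 ^ n))
    -- √2 < (1 + √(2^(2n+3) − 7))/2^(n+1), squared out
    × (64 < 2 ^ (2 * n + 5))
    -- √2 < (1 + √(2^(2n+4) − 7))/(√2·2^(n+1)), squared out
    × (8 < 2 ^ (n + 3))
proposition7p3 n 1≤n =
    (λ d Δ≡d → Δ-lower Δ≡d
             , subst (d <_) 2ⁿ+2ⁿ≡2ⁿ⁺¹ (Δ-upper n n (subst (λ m → IsΔ m d) 2n≡n+n Δ≡d)))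
  , (λ d Δ≡d → subst (λ k → 2 ^ k ∸ 7 ≤ (2 * d ∸ 1) ^ 2) (+-assoc (2 * n) 1 3) (Δ-lower Δ≡d)
             , subst (d <_) 2ⁿ⁺¹+2ⁿ≡3*2ⁿ
                 (Δ-upper (suc n) n (subst (λ m → IsΔ m d) 2n+1≡[1+n]+n Δ≡d)))
  , ^-monoʳ-< 2 (n<1+n 1) {6} {2 * n + 5} (+-monoˡ-≤ 5 (*-monoʳ-≤ 2 1≤n))
  , ^-monoʳ-< 2 (n<1+n 1) {3} {n + 3} (+-monoˡ-≤ 3 1≤n)
  where
  2n≡n+n : 2 * n ≡ n + n
  2n≡n+n = cong (n +_) (+-identityʳ n)
  2n+1≡[1+n]+n : 2 * n + 1 ≡ suc n + n
  2n+1≡[1+n]+n = trans (+-comm (2 * n) 1) (cong suc 2n≡n+n)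
  2ⁿ+2ⁿ≡2ⁿ⁺¹ : 2 ^ n + 2 ^ n ≡ 2 ^ (n + 1)
  2ⁿ+2ⁿ≡2ⁿ⁺¹ = trans (cong (2 ^ n +_) (sym (+-identityʳ _))) (cong (2 ^_) (+-comm 1 n))
  2ⁿ⁺¹+2ⁿ≡3*2ⁿ : 2 ^ suc n + 2 ^ n ≡ 3 * 2 ^ n
  2ⁿ⁺¹+2ⁿ≡3*2ⁿ = +-comm (2 ^ suc n) (2 ^ n)
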